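{- Let $\Omega_A$ be an ordered context, $A_m$ a proposition of mode $m$, $C_r$ a proposition of mode $r$, $x$ a variable, and $n\geq 0$, such that $\Omega_A \geq m \geq r$ and $|m|\sim n$. Let $\Omega(x{:}A_m)^n$ denote an ordered context containing exactly $n$ occurrences of $x{:}A_m$ distributed among the other antecedents of $\Omega$, with $x$ not occurring in $\Omega_A$ nor elsewhere in $\Omega$, and let $\Omega(\Omega_A)^n$ denote the context obtained by replacing each of these $n$ occurrences by the sequence $\Omega_A$. If $\Omega_A \vdash A_m$ and $\Omega(x{:}A_m)^n \vdash C_r$ both have cut-free derivations in the ordered adjoint sequent calculus, then $\Omega(\Omega_A)^n \vdash C_r$ has a cut-free derivation.
   Context: Ordered adjoint sequent calculus. Fix a preorder $(\mathcal{M},\geq)$ of modes and, for each mode $m$, a set $\sigma(m)\subseteq\{\mathsf{W},\mathsf{C}^\leftarrow,\mathsf{C}^\rightarrow,\mathsf{M}^\leftarrow,\mathsf{M}^\rightarrow\}$ of structural properties (weakening, left/right contraction, left/right mobility) which is monotone: $k\geq m$ implies $\sigma(k)\supseteq\sigma(m)$. Propositions are indexed by modes: $A_m ::= P_m \mid A_m \rightarrowtail B_m \mid A_m \twoheadrightarrow B_m \mid A_m \,\&\, B_m \mid {\uparrow}^m_l A_l\ (m\geq l) \mid A_m\bullet B_m \mid 1_m \mid A_m\oplus B_m \mid {\downarrow}^k_m A_k\ (k\geq m)$, with $P_m$ atomic. An ordered context $\Omega$ is a finite sequence of labeled antecedents $x{:}A_m$; the same variable may occur several times, but all its occurrences label the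 same proposition. $\Omega\geq m$ means every antecedent $y{:}B_k$ of $\Omega$ satisfies $k\geq m$. A sequent $\Omega\vdash C_r$ presupposes $\Omega\geq r$. Variables newly introduced in premises are fresh. Rules (premises $\Rightarrow$ conclusion): (id) $\Rightarrow x{:}A_m\vdash A_m$. (cut) $\Omega_A\vdash A_m$ and $\Omega_L(x{:}A_m)\Omega_R\vdash C_r$ with $\Omega_A\geq m\geq r$ $\Rightarrow \Omega_L\Omega_A\Omega_R\vdash C_r$. ($1R$) $\Rightarrow \cdot\vdash 1_m$. ($1L$) $\Omega_L\Omega_R\vdash C_r \Rightarrow \Omega_L(x{:}1_m)\Omega_R\vdash C_r$. ($\bullet R$) $\Omega_1\vdash A_m$, $\Omega_2\vdash B_m\Rightarrow \Omega_1\Omega_2\vdash A_m\bullet B_m$. ($\bullet L$) $\Omega_L(x_1{:}A_m)(x_2{:}B_m)\Omega_R\vdash C_r\Rightarrow\Omega_L(x{:}A_m\bullet B_m)\Omega_R\vdash C_r$. ($\oplus R_i$) $\Omega\vdash A_m$ (resp. $\Omega\vdash B_m$) $\Rightarrow\Omega\vdash A_m\oplus B_m$. ($\oplus L$) $\Omega_L(y{:}A_m)\Omega_R\vdash C_r$ and $\Omega_L(y{:}B_m)\Omega_R\vdash C_r\Rightarrow\Omega_L(x{:}A_m\oplus B_m)\Omega_R\vdash C_r$. (${\downarrow}R$) $\Omega\vdash A_k$ with $\Omega\geq k\Rightarrow\Omega\vdash{\downarrow}^k_mA_k$. (${\downarrow}L$) $\Omega_L(y{:}A_k)\Omega_R\vdash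 C_r\Rightarrow\Omega_L(x{:}{\downarrow}^k_mA_k)\Omega_R\vdash C_r$. ($\twoheadrightarrow R$) $\Omega(x{:}A_m)\vdash B_m\Rightarrow\Omega\vdash A_m\twoheadrightarrow B_m$. ($\twoheadrightarrow L$) $\Omega_A\vdash A_m$, $\Omega_A\geq m$, $\Omega_L(y{:}B_m)\Omega_R\vdash C_r\Rightarrow\Omega_L(f{:}A_m\twoheadrightarrow B_m)\Omega_A\Omega_R\vdash C_r$. ($\rightarrowtail R$) $(x{:}A_m)\Omega\vdash B_m\Rightarrow\Omega\vdash A_m\rightarrowtail B_m$. ($\rightarrowtail L$) $\Omega_A\vdash A_m$, $\Omega_A\geq m$, $\Omega_L(y{:}B_m)\Omega_R\vdash C_r\Rightarrow\Omega_L\Omega_A(f{:}A_m\rightarrowtail B_m)\Omega_R\vdash C_r$. ($\& R$) $\Omega\vdash A_m$, $\Omega\vdash B_m\Rightarrow\Omega\vdash A_m\&B_m$. ($\& L_i$) $\Omega_L(y{:}A_m)\Omega_R\vdash C_r$ (resp. $y{:}B_m$) $\Rightarrow\Omega_L(x{:}A_m\&B_m)\Omega_R\vdash C_r$. (${\uparrow}R$) $\Omega\vdash A_l\Rightarrow\Omega\vdash{\uparrow}^m_lA_l$. (${\uparrow}L$) $\Omega_L(y{:}A_l)\Omega_R\vdash C_r$ with $l\geq r\Rightarrow\Omega_L(x{:}{\uparrow}^m_lA_l)\Omega_R\vdash C_r$. Structural rules: ($\mathsf{M}^\leftarrow$) $\Omega_L\Omega_M(x{:}A_m)\Omega_R\vdash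 C_r$, $\mathsf{M}^\leftarrow\in\sigma(m)\Rightarrow\Omega_L(x{:}A_m)\Omega_M\Omega_R\vdash C_r$. ($\mathsf{M}^\rightarrow$) $\Omega_L(x{:}A_m)\Omega_M\Omega_R\vdash C_r$, $\mathsf{M}^\rightarrow\in\sigma(m)\Rightarrow\Omega_L\Omega_M(x{:}A_m)\Omega_R\vdash C_r$. ($\mathsf{C}^\leftarrow$) $\Omega_L(x{:}A_m)\Omega_M(x{:}A_m)\Omega_R\vdash C_r$, $\mathsf{C}^\leftarrow\in\sigma(m)\Rightarrow\Omega_L(x{:}A_m)\Omega_M\Omega_R\vdash C_r$. ($\mathsf{C}^\rightarrow$) $\Omega_L(x{:}A_m)\Omega_M(x{:}A_m)\Omega_R\vdash C_r$, $\mathsf{C}^\rightarrow\in\sigma(m)\Rightarrow\Omega_L\Omega_M(x{:}A_m)\Omega_R\vdash C_r$. ($\mathsf{W}$) $\Omega_L\Omega_R\vdash C_r$, $\mathsf{W}\in\sigma(m)\Rightarrow\Omega_L(x{:}A_m)\Omega_R\vdash C_r$. A derivation is cut-free if it does not use (cut). The compatibility relation $|m|\sim n$ holds iff: $n=0$ and $\mathsf{W}\in\sigma(m)$; or $n=1$; or $n>1$ and ($\mathsf{C}^\leftarrow\in\sigma(m)$ or $\mathsf{C}^\rightarrow\in\sigma(m)$). -}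

module Defs where

open import Data.Nat using (ℕ; zero; suc)
open import Data.Bool using (Bool; true; false)
open import Data.List using (List; []; _∷_; _++_; [_])
open import Data.List.Relation.Unary.All using (All)
open import Data.List.Membership.Propositional using (_∈_)
open import Data.Sum using (_⊎_)
open import Data.Unit using (⊤)
open import Data.Product using (_×_)
open import Relation.Binary.PropositionalEquality using (_≡_; _≢_)

-- Structural properties: weakening, left/right contraction, left/right mobility.
data Struct : Set where
  W Cˡ Cʳ Mˡ Mʳ : Struct

-- A preorder of modes (M, ≥) together with a monotone assignment σ of
-- structural properties; `Has m s` means s ∈ σ(m).
record ModeSystem : Set₁ where
  field
    Mode    : Set
    _≽_     : Mode → Mode → Set
    ≽-refl  : ∀ {m} → m ≽ m
    ≽-trans : ∀ {k l m} → k ≽ l → l ≽ m → k ≽ m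
    Has     : Mode → Struct → Set
    Has-mono : ∀ {k m s} → k ≽ m → Has m s → Has k s

module Calculus (MS : ModeSystem) where
  open ModeSystem MS

  data Prop : Mode → Set where
    atom  : ∀ {m} → ℕ → Prop m
    _↣_   : ∀ {m} → Prop m → Prop m → Prop m
    _↠_   : ∀ {m} → Prop m → Prop m → Prop m
    _&_   : ∀ {m} → Prop m → Prop m → Prop m
    up    : ∀ {m l} → m ≽ l → Prop l → Prop m
    _●_   : ∀ {m} → Prop m → Prop m → Prop m
    one   : ∀ {m} → Prop m
    _⊕_   : ∀ {m} → Prop m → Prop m → Prop m
    down  : ∀ {k m} → k ≽ m → Prop k → Prop m

  data Ante : Set where
    _∶_ : ∀ {m} → ℕ → Prop m → Ante

  varOf : Ante → ℕ
  varOf (x ∶ _) = x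

  modeOf : Ante → Mode
  modeOf (_∶_ {m} _ _) = m

  Ctx : Set
  Ctx = List Ante

  _≥ctx_ : Ctx → Mode → Set
  Ω ≥ctx m = All (λ a → modeOf a ≽ m) Ω

  _∉vars_ : ℕ → Ctx → Set
  x ∉vars Ω = All (λ a → varOf a ≢ x) Ω

  WellFormed : Ctx → Set
  WellFormed Ω = ∀ {a b} → a ∈ Ω → b ∈ Ω → varOf a ≡ varOf b → a ≡ b

  -- The flag `c` says whether (cut) is permitted:
  -- `Der false Ω C` is exactly a cut-free derivation of Ω ⊢ C. Presuppositions Ω ≥ r of conclusions are imposed
  -- explicitly in those rules where they do not already follow from the premises.
  data Der (c : Bool) : Ctx → ∀ {r} → Prop r → Set where
    id  : ∀ {m x} {A : Prop m} → Der c [ x ∶ A ] A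
    cut : ∀ {m r x ΩA ΩL ΩR} {A : Prop m} {C : Prop r} →
          c ≡ true → ΩA ≥ctx m → m ≽ r → x ∉vars (ΩL ++ ΩA ++ ΩR) →
          Der c ΩA A → Der c (ΩL ++ (x ∶ A) ∷ ΩR) C →
          Der c (ΩL ++ ΩA ++ ΩR) C
    1R  : ∀ {m} → Der c [] (one {m})
    1L  : ∀ {m r x ΩL ΩR} {C : Prop r} →
          (ΩL ++ (x ∶ one {m}) ∷ ΩR) ≥ctx r →
          Der c (ΩL ++ ΩR) C →
          Der c (ΩL ++ (x ∶ one {m}) ∷ ΩR) C
    ●R  : ∀ {m Ω₁ Ω₂} {A B : Prop m} →
          Der c Ω₁ A → Der c Ω₂ B → Der c (Ω₁ ++ Ω₂) (A ● B)
    ●L  : ∀ {m r x x₁ x₂ ΩL ΩR} {A B : Prop m} {C : Prop r} →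
          x₁ ≢ x₂ → x₁ ∉vars (ΩL ++ (x ∶ (A ● B)) ∷ ΩR) → x₂ ∉vars (ΩL ++ (x ∶ (A ● B)) ∷ ΩR) →
          Der c (ΩL ++ (x₁ ∶ A) ∷ (x₂ ∶ B) ∷ ΩR) C →
          Der c (ΩL ++ (x ∶ (A ● B)) ∷ ΩR) C
    ⊕R₁ : ∀ {m Ω} {A B : Prop m} → Der c Ω A → Der c Ω (A ⊕ B)
    ⊕R₂ : ∀ {m Ω} {A B : Prop m} → Der c Ω B → Der c Ω (A ⊕ B)
    ⊕L  : ∀ {m r x y ΩL ΩR} {A B : Prop m} {C : Prop r} →
          y ∉vars (ΩL ++ (x ∶ (A ⊕ B)) ∷ ΩR) →
          Der c (ΩL ++ (y ∶ A) ∷ ΩR) C → Der c (ΩL ++ (y ∶ B) ∷ ΩR) C →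
          Der c (ΩL ++ (x ∶ (A ⊕ B)) ∷ ΩR) C
    ↓R  : ∀ {k m Ω} {p : k ≽ m} {A : Prop k} →
          Ω ≥ctx k → Der c Ω A → Der c Ω (down p A)
    ↓L  : ∀ {k m r x y ΩL ΩR} {p : k ≽ m} {A : Prop k} {C : Prop r} →
          (ΩL ++ (x ∶ down p A) ∷ ΩR) ≥ctx r →
          y ∉vars (ΩL ++ (x ∶ down p A) ∷ ΩR) →
          Der c (ΩL ++ (y ∶ A) ∷ ΩR) C →
          Der c (ΩL ++ (x ∶ down p A) ∷ ΩR) C
    ↠R  : ∀ {m x Ω} {A B : Prop m} →
          x ∉vars Ω → Der c (Ω ++ [ x ∶ A ]) B → Der c Ω (A ↠ B)
    ↠L  : ∀ {m r f y ΩA ΩL ΩR} {A B : Prop m} {C : Prop r} →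
          ΩA ≥ctx m → y ∉vars (ΩL ++ (f ∶ (A ↠ B)) ∷ ΩA ++ ΩR) →
          Der c ΩA A → Der c (ΩL ++ (y ∶ B) ∷ ΩR) C →
          Der c (ΩL ++ (f ∶ (A ↠ B)) ∷ ΩA ++ ΩR) C
    ↣R  : ∀ {m x Ω} {A B : Prop m} →
          x ∉vars Ω → Der c ((x ∶ A) ∷ Ω) B → Der c Ω (A ↣ B)
    ↣L  : ∀ {m r f y ΩA ΩL ΩR} {A B : Prop m} {C : Prop r} →
          ΩA ≥ctx m → y ∉vars (ΩL ++ ΩA ++ (f ∶ (A ↣ B)) ∷ ΩR) →
          Der c ΩA A → Der c (ΩL ++ (y ∶ B) ∷ ΩR) C →
          Der c (ΩL ++ ΩA ++ (f ∶ (A ↣ B)) ∷ ΩR) C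
    &R  : ∀ {m Ω} {A B : Prop m} → Der c Ω A → Der c Ω B → Der c Ω (A & B)
    &L₁ : ∀ {m r x y ΩL ΩR} {A B : Prop m} {C : Prop r} →
          y ∉vars (ΩL ++ (x ∶ (A & B)) ∷ ΩR) →
          Der c (ΩL ++ (y ∶ A) ∷ ΩR) C → Der c (ΩL ++ (x ∶ (A & B)) ∷ ΩR) C
    &L₂ : ∀ {m r x y ΩL ΩR} {A B : Prop m} {C : Prop r} →
          y ∉vars (ΩL ++ (x ∶ (A & B)) ∷ ΩR) →
          Der c (ΩL ++ (y ∶ B) ∷ ΩR) C → Der c (ΩL ++ (x ∶ (A & B)) ∷ ΩR) C
    ↑R  : ∀ {m l Ω} {p : m ≽ l} {A : Prop l} →
          Ω ≥ctx m → Der c Ω A → Der c Ω (up p A)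
    ↑L  : ∀ {m l r x y ΩL ΩR} {p : m ≽ l} {A : Prop l} {C : Prop r} →
          l ≽ r → y ∉vars (ΩL ++ (x ∶ up p A) ∷ ΩR) →
          Der c (ΩL ++ (y ∶ A) ∷ ΩR) C →
          Der c (ΩL ++ (x ∶ up p A) ∷ ΩR) C
    Mˡ-rule : ∀ {m r x ΩL ΩM ΩR} {A : Prop m} {C : Prop r} → Has m Mˡ →
          Der c (ΩL ++ ΩM ++ (x ∶ A) ∷ ΩR) C → Der c (ΩL ++ (x ∶ A) ∷ ΩM ++ ΩR) C
    Mʳ-rule : ∀ {m r x ΩL ΩM ΩR} {A : Prop m} {C : Prop r} → Has m Mʳ →
          Der c (ΩL ++ (x ∶ A) ∷ ΩM ++ ΩR) C → Der c (ΩL ++ ΩM ++ (x ∶ A) ∷ ΩR) C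
    Cˡ-rule : ∀ {m r x ΩL ΩM ΩR} {A : Prop m} {C : Prop r} → Has m Cˡ →
          Der c (ΩL ++ (x ∶ A) ∷ ΩM ++ (x ∶ A) ∷ ΩR) C → Der c (ΩL ++ (x ∶ A) ∷ ΩM ++ ΩR) C
    Cʳ-rule : ∀ {m r x ΩL ΩM ΩR} {A : Prop m} {C : Prop r} → Has m Cʳ →
          Der c (ΩL ++ (x ∶ A) ∷ ΩM ++ (x ∶ A) ∷ ΩR) C → Der c (ΩL ++ ΩM ++ (x ∶ A) ∷ ΩR) C
    W-rule  : ∀ {m r x ΩL ΩR} {A : Prop m} {C : Prop r} → Has m W →
          (ΩL ++ (x ∶ A) ∷ ΩR) ≥ctx r →
          Der c (ΩL ++ ΩR) C → Der c (ΩL ++ (x ∶ A) ∷ ΩR) C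

  CutFree : ∀ {r} → Ctx → Prop r → Set
  CutFree Ω C = Der false Ω C

  -- Contexts with holes Ω(−)^n: each hole marks one occurrence position.
  data Slot : Set where
    hole : Slot
    ant  : Ante → Slot

  HCtx : Set
  HCtx = List Slot

  holes : HCtx → ℕ
  holes [] = 0
  holes (hole ∷ Ω) = suc (holes Ω)
  holes (ant _ ∷ Ω) = holes Ω

  fill : HCtx → Ctx → Ctx
  fill [] Δ = []
  fill (hole ∷ Ω) Δ = Δ ++ fill Ω Δ
  fill (ant a ∷ Ω) Δ = a ∷ fill Ω Δ

  _∉hvars_ : ℕ → HCtx → Set
  x ∉hvars [] = ⊤
  x ∉hvars (hole ∷ Ω) = x ∉hvars Ω
  x ∉hvars (ant a ∷ Ω) = (varOf a ≢ x) × (x ∉hvars Ω)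

  Compat : Mode → ℕ → Set
  Compat m zero = Has m W
  Compat m (suc zero) = ⊤
  Compat m (suc (suc n)) = Has m Cˡ ⊎ Has m Cʳ

-- Erase the variable labels.  The resulting calculus has the same rules, with contexts of
-- mode-indexed propositions and no freshness conditions, and cut-free derivations pass back
-- and forth by erasing and by choosing fresh labels again.  There the multicut "replace some
-- occurrences of A by Ω_A" is admissible, by induction on the cut formula, then on the
-- derivation of A, then on the derivation into which A is cut.  When the latter ends in a
-- left rule on a replaced occurrence, its premises are treated first; the cut is then pushed
-- up the derivation of A, past its left and structural rules, until that derivation ends in
-- the matching right rule, where the cut reduces to cuts on immediate subformulas.  A structural rule
-- applied to a replaced occurrence is applied to every antecedent of Ω_A instead; they all
-- enjoy it since Ω_A ≥ m and σ is monotone.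
module Submission where

open import Data.Nat using (ℕ; suc; _≤_; s≤s)
open import Data.Nat.Properties using (<⇒≢; <-≤-trans; ≤-refl; n≤1+n; n<1+n)
open import Data.List using (List; []; _∷_; _++_; [_]; map)
open import Data.List.Properties using (++-assoc; ++-identityʳ; map-++; ∷-injective)
open import Data.List.Extrema.Nat using (max; xs≤max)
open import Data.List.Relation.Unary.All as All using (All; []; _∷_)
open import Data.List.Relation.Unary.All.Properties using (++⁺; ++⁻ˡ; ++⁻ʳ; map⁺; map⁻)
open import Data.List.Relation.Binary.Permutation.Propositional using (↭-sym)
open import Data.List.Relation.Binary.Permutation.Propositional.Properties
  using (All-resp-↭; shift) renaming (++⁺ˡ to ↭-++⁺ˡ)
open import Data.Product using (Σ; _,_; proj₁; proj₂; _×_; ∃₂)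
open import Relation.Binary.PropositionalEquality
  using (_≡_; refl; sym; trans; cong; subst; module ≡-Reasoning)
open import Defs

map-++⁻ : ∀ {A B : Set} (f : A → B) xs ys {zs} → map f xs ≡ ys ++ zs →
          ∃₂ λ xs₁ xs₂ → xs ≡ xs₁ ++ xs₂ × map f xs₁ ≡ ys × map f xs₂ ≡ zs
map-++⁻ f xs       []       eq = [] , xs , refl , refl , eq
map-++⁻ f (x ∷ xs) (y ∷ ys) eq with ∷-injective eq
... | refl , eq′ with map-++⁻ f xs ys eq′
...   | xs₁ , xs₂ , refl , refl , refl = x ∷ xs₁ , xs₂ , refl , refl , refl

module Unlabelled (MS : ModeSystem) where
  open ModeSystem MS
  open Calculus MS using (Prop; one; _●_; _⊕_; _&_; _↠_; _↣_; up; down)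

  Formula : Set
  Formula = Σ Mode Prop

  ⟪_⟫ : ∀ {m} → Prop m → Formula
  ⟪_⟫ {m} A = m , A

  Context : Set
  Context = List Formula

  infix 4 _≥_ _⊢_

  _≥_ : Context → Mode → Set
  Δ ≥ k = All (λ a → proj₁ a ≽ k) Δ

  data _⊢_ : Context → ∀ {r} → Prop r → Set where
    id  : ∀ {m} {A : Prop m} → [ ⟪ A ⟫ ] ⊢ A
    1R  : ∀ {m} → [] ⊢ one {m}
    1L  : ∀ {m r ΩL ΩR} {C : Prop r} →
          ΩL ++ ⟪ one {m} ⟫ ∷ ΩR ≥ r → ΩL ++ ΩR ⊢ C → ΩL ++ ⟪ one {m} ⟫ ∷ ΩR ⊢ C
    ●R  : ∀ {m Ω₁ Ω₂} {A B : Prop m} → Ω₁ ⊢ A → Ω₂ ⊢ B → Ω₁ ++ Ω₂ ⊢ A ● B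
    ●L  : ∀ {m r ΩL ΩR} {A B : Prop m} {C : Prop r} →
          ΩL ++ ⟪ A ⟫ ∷ ⟪ B ⟫ ∷ ΩR ⊢ C → ΩL ++ ⟪ A ● B ⟫ ∷ ΩR ⊢ C
    ⊕R₁ : ∀ {m Ω} {A B : Prop m} → Ω ⊢ A → Ω ⊢ A ⊕ B
    ⊕R₂ : ∀ {m Ω} {A B : Prop m} → Ω ⊢ B → Ω ⊢ A ⊕ B
    ⊕L  : ∀ {m r ΩL ΩR} {A B : Prop m} {C : Prop r} →
          ΩL ++ ⟪ A ⟫ ∷ ΩR ⊢ C → ΩL ++ ⟪ B ⟫ ∷ ΩR ⊢ C → ΩL ++ ⟪ A ⊕ B ⟫ ∷ ΩR ⊢ C
    ↓R  : ∀ {k m Ω} {p : k ≽ m} {A : Prop k} → Ω ≥ k → Ω ⊢ A → Ω ⊢ down p A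
    ↓L  : ∀ {k m r ΩL ΩR} {p : k ≽ m} {A : Prop k} {C : Prop r} →
          ΩL ++ ⟪ down p A ⟫ ∷ ΩR ≥ r → ΩL ++ ⟪ A ⟫ ∷ ΩR ⊢ C → ΩL ++ ⟪ down p A ⟫ ∷ ΩR ⊢ C
    ↠R  : ∀ {m Ω} {A B : Prop m} → Ω ++ [ ⟪ A ⟫ ] ⊢ B → Ω ⊢ A ↠ B
    ↠L  : ∀ {m r ΩA ΩL ΩR} {A B : Prop m} {C : Prop r} →
          ΩA ≥ m → ΩA ⊢ A → ΩL ++ ⟪ B ⟫ ∷ ΩR ⊢ C → ΩL ++ ⟪ A ↠ B ⟫ ∷ ΩA ++ ΩR ⊢ C
    ↣R  : ∀ {m Ω} {A B : Prop m} → ⟪ A ⟫ ∷ Ω ⊢ B → Ω ⊢ A ↣ B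
    ↣L  : ∀ {m r ΩA ΩL ΩR} {A B : Prop m} {C : Prop r} →
          ΩA ≥ m → ΩA ⊢ A → ΩL ++ ⟪ B ⟫ ∷ ΩR ⊢ C → ΩL ++ ΩA ++ ⟪ A ↣ B ⟫ ∷ ΩR ⊢ C
    &R  : ∀ {m Ω} {A B : Prop m} → Ω ⊢ A → Ω ⊢ B → Ω ⊢ A & B
    &L₁ : ∀ {m r ΩL ΩR} {A B : Prop m} {C : Prop r} →
          ΩL ++ ⟪ A ⟫ ∷ ΩR ⊢ C → ΩL ++ ⟪ A & B ⟫ ∷ ΩR ⊢ C
    &L₂ : ∀ {m r ΩL ΩR} {A B : Prop m} {C : Prop r} →
          ΩL ++ ⟪ B ⟫ ∷ ΩR ⊢ C → ΩL ++ ⟪ A & B ⟫ ∷ ΩR ⊢ C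
    ↑R  : ∀ {m l Ω} {p : m ≽ l} {A : Prop l} → Ω ≥ m → Ω ⊢ A → Ω ⊢ up p A
    ↑L  : ∀ {m l r ΩL ΩR} {p : m ≽ l} {A : Prop l} {C : Prop r} →
          l ≽ r → ΩL ++ ⟪ A ⟫ ∷ ΩR ⊢ C → ΩL ++ ⟪ up p A ⟫ ∷ ΩR ⊢ C
    Mˡ-rule : ∀ {r a ΩL ΩM ΩR} {C : Prop r} → Has (proj₁ a) Mˡ →
              ΩL ++ ΩM ++ a ∷ ΩR ⊢ C → ΩL ++ a ∷ ΩM ++ ΩR ⊢ C
    Mʳ-rule : ∀ {r a ΩL ΩM ΩR} {C : Prop r} → Has (proj₁ a) Mʳ →
              ΩL ++ a ∷ ΩM ++ ΩR ⊢ C → ΩL ++ ΩM ++ a ∷ ΩR ⊢ C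
    Cˡ-rule : ∀ {r a ΩL ΩM ΩR} {C : Prop r} → Has (proj₁ a) Cˡ →
              ΩL ++ a ∷ ΩM ++ a ∷ ΩR ⊢ C → ΩL ++ a ∷ ΩM ++ ΩR ⊢ C
    Cʳ-rule : ∀ {r a ΩL ΩM ΩR} {C : Prop r} → Has (proj₁ a) Cʳ →
              ΩL ++ a ∷ ΩM ++ a ∷ ΩR ⊢ C → ΩL ++ ΩM ++ a ∷ ΩR ⊢ C
    W-rule  : ∀ {r a ΩL ΩR} {C : Prop r} → Has (proj₁ a) W →
              ΩL ++ a ∷ ΩR ≥ r → ΩL ++ ΩR ⊢ C → ΩL ++ a ∷ ΩR ⊢ C

  private variable
    k m r : Mode
    a b : Formula
    Δ Δ′ L L′ M N R R′ X : Context

  ≥-≽-trans : X ≥ k → k ≽ m → X ≥ m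
  ≥-≽-trans g k≽m = All.map (λ p → ≽-trans p k≽m) g

  ≥-at : ∀ L → L ++ a ∷ R ≥ r → proj₁ a ≽ r
  ≥-at L g = All.head (++⁻ʳ L g)

  ≥-replace : ∀ L M → L ++ M ++ R ≥ r → N ≥ r → L ++ N ++ R ≥ r
  ≥-replace L M g n = ++⁺ (++⁻ˡ L g) (++⁺ n (++⁻ʳ M (++⁻ʳ L g)))

  ≥-drop : ∀ L → L ++ a ∷ R ≥ r → L ++ R ≥ r
  ≥-drop L g = ≥-replace L [ _ ] g []

  ≥-principal : ∀ L M → L ++ a ∷ M ++ R ≥ r → (proj₁ a ≽ r → proj₁ b ≽ r) → L ++ b ∷ R ≥ r
  ≥-principal L M g f = ≥-replace L (_ ∷ M) g (f (≥-at L g) ∷ [])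

  presupposition : ∀ {C : Prop r} → Δ ⊢ C → Δ ≥ r
  presupposition id = ≽-refl ∷ []
  presupposition 1R = []
  presupposition (1L s _) = s
  presupposition (●R d e) = ++⁺ (presupposition d) (presupposition e)
  presupposition (●L {ΩL = L} d) = ≥-principal L [ _ ] (presupposition d) (λ m≽r → m≽r)
  presupposition (⊕R₁ d) = presupposition d
  presupposition (⊕R₂ d) = presupposition d
  presupposition (⊕L {ΩL = L} d _) = ≥-principal L [] (presupposition d) (λ m≽r → m≽r)
  presupposition (↓R {p = p} s _) = ≥-≽-trans s p
  presupposition (↓L s _) = s
  presupposition (↠R {Ω = Ω} d) = ++⁻ˡ Ω (presupposition d)
  presupposition (↠L {ΩL = L} s _ d) =
    let g = presupposition d ; m≽r = ≥-at L g
    in  ≥-replace L [ _ ] g (m≽r ∷ ≥-≽-trans s m≽r)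
  presupposition (↣R d) = All.tail (presupposition d)
  presupposition (↣L {ΩL = L} s _ d) =
    let g = presupposition d ; m≽r = ≥-at L g
    in  ++⁺ (++⁻ˡ L g) (++⁺ (≥-≽-trans s m≽r) (m≽r ∷ All.tail (++⁻ʳ L g)))
  presupposition (&R d _) = presupposition d
  presupposition (&L₁ {ΩL = L} d) = ≥-principal L [] (presupposition d) (λ m≽r → m≽r)
  presupposition (&L₂ {ΩL = L} d) = ≥-principal L [] (presupposition d) (λ m≽r → m≽r)
  presupposition (↑R s _) = s
  presupposition (↑L {ΩL = L} {p = p} _ d) = ≥-principal L [] (presupposition d) (≽-trans p)
  presupposition (Mˡ-rule {ΩL = L} {ΩM = M} _ d) =
    All-resp-↭ (↭-++⁺ˡ L (shift _ M _)) (presupposition d)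
  presupposition (Mʳ-rule {ΩL = L} {ΩM = M} _ d) =
    All-resp-↭ (↭-sym (↭-++⁺ˡ L (shift _ M _))) (presupposition d)
  presupposition (Cˡ-rule {a = a} {ΩL = L} _ d) =
    let g = presupposition d in ++⁺ (++⁻ˡ L g) (≥-drop (a ∷ _) (++⁻ʳ L g))
  presupposition (Cʳ-rule {ΩL = L} _ d) = ≥-drop L (presupposition d)
  presupposition (W-rule _ s _) = s

  AllHave : Struct → Context → Set
  AllHave s X = All (λ a → Has (proj₁ a) s) X

  allHave : ∀ {s} → X ≥ m → Has m s → AllHave s X
  allHave g h = All.map (λ k≽m → Has-mono k≽m h) g

  ⊢-snoc : ∀ {C : Prop r} L a Y → (L ++ [ a ]) ++ Y ⊢ C → L ++ a ∷ Y ⊢ C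
  ⊢-snoc {C = C} L a Y = subst (_⊢ C) (++-assoc L [ a ] Y)

  ⊢-unsnoc : ∀ {C : Prop r} L a Y → L ++ a ∷ Y ⊢ C → (L ++ [ a ]) ++ Y ⊢ C
  ⊢-unsnoc {C = C} L a Y = subst (_⊢ C) (sym (++-assoc L [ a ] Y))

  W-block : ∀ {C : Prop r} L → AllHave W X → L ++ X ++ R ≥ r → L ++ R ⊢ C → L ++ X ++ R ⊢ C
  W-block L []       _ d = d
  W-block L (h ∷ hs) g d = W-rule h g (W-block L hs (≥-drop L g) d)

  Mˡ-block : ∀ {C : Prop r} L M → AllHave Mˡ X → L ++ M ++ X ++ R ⊢ C → L ++ X ++ M ++ R ⊢ C
  Mˡ-block L M []       d = d
  Mˡ-block {X = a ∷ X} L M (h ∷ hs) d =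
    ⊢-snoc L a _ (Mˡ-block (L ++ [ a ]) M hs (⊢-unsnoc L a _ (Mˡ-rule {ΩL = L} {ΩM = M} h d)))

  Mʳ-block : ∀ {C : Prop r} L M → AllHave Mʳ X → L ++ X ++ M ++ R ⊢ C → L ++ M ++ X ++ R ⊢ C
  Mʳ-block L M []       d = d
  Mʳ-block {X = a ∷ X} L M (h ∷ hs) d =
    Mʳ-rule {ΩL = L} {ΩM = M} h (⊢-snoc L a _ (Mʳ-block (L ++ [ a ]) M hs (⊢-unsnoc L a _ d)))

  Cˡ-block : ∀ {C : Prop r} L M → AllHave Cˡ X → L ++ X ++ M ++ X ++ R ⊢ C → L ++ X ++ M ++ R ⊢ C
  Cˡ-block L M []       d = d
  Cˡ-block {X = a ∷ X} {C = C} L M (h ∷ hs) d =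
    ⊢-snoc L a _ (Cˡ-block (L ++ [ a ]) M hs (⊢-unsnoc L a _
      (subst (_⊢ C) (cong (λ Y → L ++ a ∷ Y) (++-assoc X M _))
        (Cˡ-rule {ΩL = L} {ΩM = X ++ M} h
          (subst (_⊢ C) (cong (λ Y → L ++ a ∷ Y) (sym (++-assoc X M _))) d)))))

  Cʳ-block : ∀ {C : Prop r} L M → AllHave Cʳ X → L ++ X ++ M ++ X ++ R ⊢ C → L ++ M ++ X ++ R ⊢ C
  Cʳ-block L M []       d = d
  Cʳ-block {X = a ∷ X} {R = R} {C = C} L M (h ∷ hs) d =
    Cʳ-rule {ΩL = L} {ΩM = M} h (⊢-snoc L a _
      (subst (_⊢ C) (cong ((L ++ [ a ]) ++_) (++-assoc M [ a ] (X ++ R)))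
        (Cʳ-block (L ++ [ a ]) (M ++ [ a ]) hs
          (subst (_⊢ C) (cong (λ Y → (L ++ [ a ]) ++ X ++ Y) (sym (++-assoc M [ a ] (X ++ R))))
            (⊢-unsnoc L a _ d)))))

  data Replace (a : Formula) (X : Context) : Context → Context → Set where
    []      : Replace a X [] []
    keep    : ∀ {b Δ Δ′} → Replace a X Δ Δ′ → Replace a X (b ∷ Δ) (b ∷ Δ′)
    replace : ∀ {Δ Δ′} → Replace a X Δ Δ′ → Replace a X (a ∷ Δ) (X ++ Δ′)

  keep-all : ∀ Δ → Replace a X Δ Δ
  keep-all []      = []
  keep-all (_ ∷ Δ) = keep (keep-all Δ)

  infixr 5 _++ᴿ_

  _++ᴿ_ : Replace a X L L′ → Replace a X R R′ → Replace a X (L ++ R) (L′ ++ R′)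
  []     ++ᴿ σ = σ
  keep ρ ++ᴿ σ = keep (ρ ++ᴿ σ)
  _++ᴿ_ {X = X} (replace {Δ′ = Δ′} ρ) σ =
    subst (Replace _ X _) (sym (++-assoc X Δ′ _)) (replace (ρ ++ᴿ σ))

  replace-at : ∀ L R → Replace a X (L ++ a ∷ R) (L ++ X ++ R)
  replace-at L R = keep-all L ++ᴿ replace (keep-all R)

  split-++ : ∀ L → Replace a X (L ++ R) Δ′ →
             ∃₂ λ L′ R′ → Replace a X L L′ × Replace a X R R′ × Δ′ ≡ L′ ++ R′
  split-++ []      ρ = [] , _ , [] , ρ , refl
  split-++ (b ∷ L) (keep ρ) with split-++ L ρ
  ... | L′ , R′ , ρL , ρR , refl = b ∷ L′ , R′ , keep ρL , ρR , refl
  split-++ {X = X} (_ ∷ L) (replace ρ) with split-++ L ρ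
  ... | L′ , R′ , ρL , ρR , refl = X ++ L′ , R′ , replace ρL , ρR , sym (++-assoc X L′ R′)

  data Position (a : Formula) (X L R : Context) : Formula → Context → Set where
    kept     : ∀ {b L′ R′} → Replace a X L L′ → Replace a X R R′ →
               Position a X L R b (L′ ++ b ∷ R′)
    replaced : ∀ {b L′ R′} → b ≡ a → Replace a X L L′ → Replace a X R R′ →
               Position a X L R b (L′ ++ X ++ R′)

  position : ∀ L → Replace a X (L ++ b ∷ R) Δ′ → Position a X L R b Δ′
  position L ρ with split-++ L ρ
  ... | _ , _ , ρL , keep ρR    , refl = kept ρL ρR
  ... | _ , _ , ρL , replace ρR , refl = replaced refl ρL ρR

  Replace-≥ : Replace a X Δ Δ′ → Δ ≥ r → X ≥ proj₁ a → Δ′ ≥ r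
  Replace-≥ []          []      _ = []
  Replace-≥ (keep ρ)    (p ∷ g) x = p ∷ Replace-≥ ρ g x
  Replace-≥ (replace ρ) (p ∷ g) x = ++⁺ (≥-≽-trans x p) (Replace-≥ ρ g x)

  W-replace : ∀ {C : Prop r} L → X ≥ proj₁ a → Has (proj₁ b) W → L ++ b ∷ R ≥ r →
              (∀ {Δ′} → Replace a X (L ++ R) Δ′ → Δ′ ⊢ C) →
              Replace a X (L ++ b ∷ R) Δ′ → Δ′ ⊢ C
  W-replace L x h s premise ρ with position L ρ
  ... | kept ρL ρR = W-rule h (Replace-≥ ρ s x) (premise (ρL ++ᴿ ρR))
  ... | replaced {L′ = L′} refl ρL ρR =
    W-block L′ (allHave x h) (Replace-≥ ρ s x) (premise (ρL ++ᴿ ρR))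

  Mˡ-replace : ∀ {C : Prop r} L M → X ≥ proj₁ a → Has (proj₁ b) Mˡ →
               (∀ {Δ′} → Replace a X (L ++ M ++ b ∷ R) Δ′ → Δ′ ⊢ C) →
               Replace a X (L ++ b ∷ M ++ R) Δ′ → Δ′ ⊢ C
  Mˡ-replace L M x h premise ρ with position L ρ
  ... | kept ρL ρ′ with split-++ M ρ′
  ...   | _ , _ , ρM , ρR , refl = Mˡ-rule h (premise (ρL ++ᴿ ρM ++ᴿ keep ρR))
  Mˡ-replace L M x h premise ρ | replaced {L′ = L′} refl ρL ρ′ with split-++ M ρ′
  ...   | M′ , _ , ρM , ρR , refl =
    Mˡ-block L′ M′ (allHave x h) (premise (ρL ++ᴿ ρM ++ᴿ replace ρR))

  Mʳ-replace : ∀ {C : Prop r} L M → X ≥ proj₁ a → Has (proj₁ b) Mʳ →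
               (∀ {Δ′} → Replace a X (L ++ b ∷ M ++ R) Δ′ → Δ′ ⊢ C) →
               Replace a X (L ++ M ++ b ∷ R) Δ′ → Δ′ ⊢ C
  Mʳ-replace L M x h premise ρ with split-++ L ρ
  ... | L′ , _ , ρL , ρ′ , refl with position M ρ′
  ...   | kept ρM ρR = Mʳ-rule h (premise (ρL ++ᴿ keep (ρM ++ᴿ ρR)))
  ...   | replaced {L′ = M′} refl ρM ρR =
    Mʳ-block L′ M′ (allHave x h) (premise (ρL ++ᴿ replace (ρM ++ᴿ ρR)))

  Cˡ-replace : ∀ {C : Prop r} L M → X ≥ proj₁ a → Has (proj₁ b) Cˡ →
               (∀ {Δ′} → Replace a X (L ++ b ∷ M ++ b ∷ R) Δ′ → Δ′ ⊢ C) →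
               Replace a X (L ++ b ∷ M ++ R) Δ′ → Δ′ ⊢ C
  Cˡ-replace L M x h premise ρ with position L ρ
  ... | kept ρL ρ′ with split-++ M ρ′
  ...   | _ , _ , ρM , ρR , refl = Cˡ-rule h (premise (ρL ++ᴿ keep (ρM ++ᴿ keep ρR)))
  Cˡ-replace L M x h premise ρ | replaced {L′ = L′} refl ρL ρ′ with split-++ M ρ′
  ...   | M′ , _ , ρM , ρR , refl =
    Cˡ-block L′ M′ (allHave x h) (premise (ρL ++ᴿ replace (ρM ++ᴿ replace ρR)))

  Cʳ-replace : ∀ {C : Prop r} L M → X ≥ proj₁ a → Has (proj₁ b) Cʳ →
               (∀ {Δ′} → Replace a X (L ++ b ∷ M ++ b ∷ R) Δ′ → Δ′ ⊢ C) →
               Replace a X (L ++ M ++ b ∷ R) Δ′ → Δ′ ⊢ C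
  Cʳ-replace L M x h premise ρ with split-++ L ρ
  ... | L′ , _ , ρL , ρ′ , refl with position M ρ′
  ...   | kept ρM ρR = Cʳ-rule h (premise (ρL ++ᴿ keep (ρM ++ᴿ keep ρR)))
  ...   | replaced {L′ = M′} refl ρM ρR =
    Cʳ-block L′ M′ (allHave x h) (premise (ρL ++ᴿ replace (ρM ++ᴿ replace ρR)))

  data LeftRule {r} (C : Prop r) : ∀ {m} → Prop m → Context → Context → Set where
    1L  : ∀ {m L R} → L ++ R ⊢ C → LeftRule C (one {m}) L R
    ●L  : ∀ {m L R} {A B : Prop m} → L ++ ⟪ A ⟫ ∷ ⟪ B ⟫ ∷ R ⊢ C → LeftRule C (A ● B) L R
    ⊕L  : ∀ {m L R} {A B : Prop m} →
          L ++ ⟪ A ⟫ ∷ R ⊢ C → L ++ ⟪ B ⟫ ∷ R ⊢ C → LeftRule C (A ⊕ B) L R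
    ↓L  : ∀ {k m L R} {p : k ≽ m} {A : Prop k} → L ++ ⟪ A ⟫ ∷ R ⊢ C → LeftRule C (down p A) L R
    ↠L  : ∀ {m L R ΩA} {A B : Prop m} →
          ΩA ⊢ A → L ++ ⟪ B ⟫ ∷ R ⊢ C → LeftRule C (A ↠ B) L (ΩA ++ R)
    ↣L  : ∀ {m L R ΩA} {A B : Prop m} →
          ΩA ⊢ A → L ++ ⟪ B ⟫ ∷ R ⊢ C → LeftRule C (A ↣ B) (L ++ ΩA) R
    &L₁ : ∀ {m L R} {A B : Prop m} → L ++ ⟪ A ⟫ ∷ R ⊢ C → LeftRule C (A & B) L R
    &L₂ : ∀ {m L R} {A B : Prop m} → L ++ ⟪ B ⟫ ∷ R ⊢ C → LeftRule C (A & B) L R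
    ↑L  : ∀ {m l L R} {p : m ≽ l} {A : Prop l} →
          l ≽ r → L ++ ⟪ A ⟫ ∷ R ⊢ C → LeftRule C (up p A) L R

  conclude : ∀ {A : Prop m} {C : Prop r} → m ≽ r → LeftRule C A L R → L ++ ⟪ A ⟫ ∷ R ⊢ C
  conclude m≽r (1L {L = L} e) = 1L (≥-replace L [] (presupposition e) (m≽r ∷ [])) e
  conclude _   (●L e)         = ●L e
  conclude _   (⊕L e₁ e₂)     = ⊕L e₁ e₂
  conclude m≽r (↓L {L = L} e) = ↓L (≥-replace L [ _ ] (presupposition e) (m≽r ∷ [])) e
  conclude _   (↠L f e)       = ↠L (presupposition f) f e
  conclude _   (↣L {L = L} {ΩA = B} f e) =
    subst (_⊢ _) (sym (++-assoc L B _)) (↣L (presupposition f) f e)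
  conclude _   (&L₁ e)        = &L₁ e
  conclude _   (&L₂ e)        = &L₂ e
  conclude _   (↑L l≽r e)     = ↑L l≽r e

  cut-≥ : ∀ {A : Prop m} {C : Prop r} → m ≽ r → LeftRule C A L R → X ⊢ A → L ++ X ++ R ≥ r
  cut-≥ {L = L} {R = R} m≽r ℓ d =
    Replace-≥ (replace-at L R) (presupposition (conclude m≽r ℓ)) (presupposition d)

  ++-regroup : ∀ (L XL M XR R : Context) → L ++ (XL ++ M ++ XR) ++ R ≡ (L ++ XL) ++ M ++ XR ++ R
  ++-regroup L XL M XR R = begin
    L ++ (XL ++ M ++ XR) ++ R    ≡⟨ cong (L ++_) (++-assoc XL (M ++ XR) R) ⟩
    L ++ XL ++ (M ++ XR) ++ R    ≡⟨ cong (λ Y → L ++ XL ++ Y) (++-assoc M XR R) ⟩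
    L ++ XL ++ M ++ XR ++ R      ≡⟨ sym (++-assoc L XL _) ⟩
    (L ++ XL) ++ M ++ XR ++ R    ∎
    where open ≡-Reasoning

  regroup-≥ : ∀ L XL M XR R → L ++ (XL ++ M ++ XR) ++ R ≥ r → (L ++ XL) ++ M ++ XR ++ R ≥ r
  regroup-≥ {r = r} L XL M XR R = subst (_≥ r) (++-regroup L XL M XR R)

  regroup : ∀ {C : Prop r} L XL M XR R →
            L ++ (XL ++ M ++ XR) ++ R ⊢ C → (L ++ XL) ++ M ++ XR ++ R ⊢ C
  regroup {C = C} L XL M XR R = subst (_⊢ C) (++-regroup L XL M XR R)

  ungroup : ∀ {C : Prop r} L XL M XR R →
            (L ++ XL) ++ M ++ XR ++ R ⊢ C → L ++ (XL ++ M ++ XR) ++ R ⊢ C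
  ungroup {C = C} L XL M XR R = subst (_⊢ C) (sym (++-regroup L XL M XR R))

  multicut : ∀ {A : Prop m} {C : Prop r} → X ⊢ A → Δ ⊢ C → Replace ⟪ A ⟫ X Δ Δ′ → Δ′ ⊢ C

  cut : ∀ {A : Prop m} {C : Prop r} L R → X ⊢ A → L ++ ⟪ A ⟫ ∷ R ⊢ C → L ++ X ++ R ⊢ C

  principal-cut : ∀ {A : Prop m} {C : Prop r} →
                  X ⊢ A → m ≽ r → LeftRule C A L R → L ++ X ++ R ⊢ C

  principal-cut-at : ∀ {A : Prop m} {C : Prop r} → X ⊢ A → b ≡ ⟪ A ⟫ → proj₁ b ≽ r →
                     LeftRule C (proj₂ b) L R → L ++ X ++ R ⊢ C

  cut L R d e = multicut d e (replace-at L R)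

  -- The cut formula is transported along b ≡ ⟪ A ⟫ instead of being unified with b, so that
  -- the termination checker sees it unchanged in the call to principal-cut.
  principal-cut-at D b≡a b≽r ℓ =
    principal-cut D (subst (λ a → proj₁ a ≽ _) b≡a b≽r)
                    (subst (λ a → LeftRule _ (proj₂ a) _ _) b≡a ℓ)

  principal-cut id m≽r ℓ = conclude m≽r ℓ
  principal-cut 1R _ (1L e) = e
  principal-cut (●R {Ω₁ = X₁} {Ω₂ = X₂} d₁ d₂) _ (●L {L = L} {R = R} e) =
    subst (_⊢ _) (cong (L ++_) (sym (++-assoc X₁ X₂ R)))
      (multicut d₂ (cut L (_ ∷ R) d₁ e) (keep-all L ++ᴿ keep-all X₁ ++ᴿ replace (keep-all R)))
  principal-cut (⊕R₁ d) _ (⊕L {L = L} {R = R} e _) = cut L R d e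
  principal-cut (⊕R₂ d) _ (⊕L {L = L} {R = R} _ e) = cut L R d e
  principal-cut (↓R _ d) _ (↓L {L = L} {R = R} e)  = cut L R d e
  principal-cut {X = X} (↠R d) _ (↠L {L = L} {R = R} {ΩA = B} f e) =
    subst (_⊢ _) (cong (L ++_) (++-assoc X B R))
      (cut L R (subst (_⊢ _) (cong (X ++_) (++-identityʳ B)) (cut X [] f d)) e)
  principal-cut {X = X} (↣R d) _ (↣L {L = L} {R = R} {ΩA = B} f e) =
    subst (_⊢ _) (trans (cong (L ++_) (++-assoc B X R)) (sym (++-assoc L B _)))
      (cut L R (cut [] X f d) e)
  principal-cut (&R d _) _ (&L₁ {L = L} {R = R} e)   = cut L R d e
  principal-cut (&R _ d) _ (&L₂ {L = L} {R = R} e)   = cut L R d e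
  principal-cut (↑R _ d) _ (↑L {L = L} {R = R} _ e)  = cut L R d e
  principal-cut {L = L} {R = R} D@(1L {ΩL = XL} {ΩR = XR} _ d) m≽r ℓ =
    ungroup L XL _ XR R (1L (regroup-≥ L XL [ _ ] XR R (cut-≥ m≽r ℓ D))
                            (regroup L XL [] XR R (principal-cut d m≽r ℓ)))
  principal-cut {L = L} {R = R} (●L {ΩL = XL} {ΩR = XR} d) m≽r ℓ =
    ungroup L XL _ XR R (●L (regroup L XL (_ ∷ _ ∷ []) XR R (principal-cut d m≽r ℓ)))
  principal-cut {L = L} {R = R} (⊕L {ΩL = XL} {ΩR = XR} d₁ d₂) m≽r ℓ =
    ungroup L XL _ XR R (⊕L (regroup L XL [ _ ] XR R (principal-cut d₁ m≽r ℓ))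
                            (regroup L XL [ _ ] XR R (principal-cut d₂ m≽r ℓ)))
  principal-cut {L = L} {R = R} D@(↓L {ΩL = XL} {ΩR = XR} _ d) m≽r ℓ =
    ungroup L XL _ XR R (↓L (regroup-≥ L XL [ _ ] XR R (cut-≥ m≽r ℓ D))
                            (regroup L XL [ _ ] XR R (principal-cut d m≽r ℓ)))
  principal-cut {L = L} {R = R} (↠L {ΩA = XB} {ΩL = XL} {ΩR = XR} s f d) m≽r ℓ =
    ungroup L XL (_ ∷ XB) XR R (↠L s f (regroup L XL [ _ ] XR R (principal-cut d m≽r ℓ)))
  principal-cut {L = L} {R = R} (↣L {ΩA = XB} {ΩL = XL} {ΩR = XR} s f d) m≽r ℓ =
    ungroup L XL XB (_ ∷ XR) R (↣L s f (regroup L XL [ _ ] XR R (principal-cut d m≽r ℓ)))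
  principal-cut {L = L} {R = R} (&L₁ {ΩL = XL} {ΩR = XR} d) m≽r ℓ =
    ungroup L XL _ XR R (&L₁ (regroup L XL [ _ ] XR R (principal-cut d m≽r ℓ)))
  principal-cut {L = L} {R = R} (&L₂ {ΩL = XL} {ΩR = XR} d) m≽r ℓ =
    ungroup L XL _ XR R (&L₂ (regroup L XL [ _ ] XR R (principal-cut d m≽r ℓ)))
  principal-cut {L = L} {R = R} (↑L {ΩL = XL} {ΩR = XR} l≽m d) m≽r ℓ =
    ungroup L XL _ XR R (↑L (≽-trans l≽m m≽r) (regroup L XL [ _ ] XR R (principal-cut d m≽r ℓ)))
  principal-cut {L = L} {R = R} (Mˡ-rule {a = c} {ΩL = XL} {ΩM = XM} {ΩR = XR} h d) m≽r ℓ =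
    ungroup L XL (c ∷ XM) XR R (Mˡ-rule h (regroup L XL XM (c ∷ XR) R (principal-cut d m≽r ℓ)))
  principal-cut {L = L} {R = R} (Mʳ-rule {a = c} {ΩL = XL} {ΩM = XM} {ΩR = XR} h d) m≽r ℓ =
    ungroup L XL XM (c ∷ XR) R (Mʳ-rule h (regroup L XL (c ∷ XM) XR R (principal-cut d m≽r ℓ)))
  principal-cut {L = L} {R = R} (Cˡ-rule {a = c} {ΩL = XL} {ΩM = XM} {ΩR = XR} h d) m≽r ℓ =
    ungroup L XL (c ∷ XM) XR R
      (Cˡ-rule h (regroup L XL (c ∷ XM) (c ∷ XR) R (principal-cut d m≽r ℓ)))
  principal-cut {L = L} {R = R} (Cʳ-rule {a = c} {ΩL = XL} {ΩM = XM} {ΩR = XR} h d) m≽r ℓ =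
    ungroup L XL XM (c ∷ XR) R
      (Cʳ-rule h (regroup L XL (c ∷ XM) (c ∷ XR) R (principal-cut d m≽r ℓ)))
  principal-cut {L = L} {R = R} D@(W-rule {a = c} {ΩL = XL} {ΩR = XR} h _ d) m≽r ℓ =
    ungroup L XL [ c ] XR R (W-rule h (regroup-≥ L XL [ _ ] XR R (cut-≥ m≽r ℓ D))
                                      (regroup L XL [] XR R (principal-cut d m≽r ℓ)))

  multicut D id (keep [])    = id
  multicut D id (replace []) = subst (_⊢ _) (sym (++-identityʳ _)) D
  multicut D 1R []           = 1R
  multicut D (●R {Ω₁ = L} e₁ e₂) ρ with split-++ L ρ
  ... | _ , _ , ρL , ρR , refl = ●R (multicut D e₁ ρL) (multicut D e₂ ρR)
  multicut D (⊕R₁ e) ρ    = ⊕R₁ (multicut D e ρ)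
  multicut D (⊕R₂ e) ρ    = ⊕R₂ (multicut D e ρ)
  multicut D (↓R s e) ρ   = ↓R (Replace-≥ ρ s (presupposition D)) (multicut D e ρ)
  multicut D (↠R e) ρ     = ↠R (multicut D e (ρ ++ᴿ keep []))
  multicut D (↣R e) ρ     = ↣R (multicut D e (keep ρ))
  multicut D (&R e₁ e₂) ρ = &R (multicut D e₁ ρ) (multicut D e₂ ρ)
  multicut D (↑R s e) ρ   = ↑R (Replace-≥ ρ s (presupposition D)) (multicut D e ρ)
  multicut D (1L {ΩL = L} s e) ρ with position L ρ
  ... | kept ρL ρR = 1L (Replace-≥ ρ s (presupposition D)) (multicut D e (ρL ++ᴿ ρR))
  ... | replaced {L′ = L′} {R′ = R′} b≡a ρL ρR =
    principal-cut-at {L = L′} {R = R′} D b≡a (≥-at L s) (1L (multicut D e (ρL ++ᴿ ρR)))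
  multicut D E@(●L {ΩL = L} e) ρ with position L ρ
  ... | kept ρL ρR = ●L (multicut D e (ρL ++ᴿ keep (keep ρR)))
  ... | replaced b≡a ρL ρR =
    principal-cut-at D b≡a (≥-at L (presupposition E)) (●L (multicut D e (ρL ++ᴿ keep (keep ρR))))
  multicut D E@(⊕L {ΩL = L} e₁ e₂) ρ with position L ρ
  ... | kept ρL ρR = ⊕L (multicut D e₁ (ρL ++ᴿ keep ρR)) (multicut D e₂ (ρL ++ᴿ keep ρR))
  ... | replaced b≡a ρL ρR =
    principal-cut-at D b≡a (≥-at L (presupposition E))
      (⊕L (multicut D e₁ (ρL ++ᴿ keep ρR)) (multicut D e₂ (ρL ++ᴿ keep ρR)))
  multicut D (↓L {ΩL = L} s e) ρ with position L ρ
  ... | kept ρL ρR = ↓L (Replace-≥ ρ s (presupposition D)) (multicut D e (ρL ++ᴿ keep ρR))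
  ... | replaced b≡a ρL ρR =
    principal-cut-at D b≡a (≥-at L s) (↓L (multicut D e (ρL ++ᴿ keep ρR)))
  multicut D E@(↠L {ΩA = B} {ΩL = L} s f e) ρ with position L ρ
  ... | kept ρL ρ′ with split-++ B ρ′
  ...   | _ , _ , ρB , ρR , refl =
    ↠L (Replace-≥ ρB s (presupposition D)) (multicut D f ρB) (multicut D e (ρL ++ᴿ keep ρR))
  multicut D E@(↠L {ΩA = B} {ΩL = L} s f e) ρ | replaced b≡a ρL ρ′ with split-++ B ρ′
  ...   | _ , _ , ρB , ρR , refl =
    principal-cut-at D b≡a (≥-at L (presupposition E))
      (↠L (multicut D f ρB) (multicut D e (ρL ++ᴿ keep ρR)))
  multicut D E@(↣L {ΩA = B} {ΩL = L} s f e) ρ with split-++ L ρ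
  ... | L′ , _ , ρL , ρ′ , refl with position B ρ′
  ...   | kept ρB ρR =
    ↣L (Replace-≥ ρB s (presupposition D)) (multicut D f ρB) (multicut D e (ρL ++ᴿ keep ρR))
  ...   | replaced {L′ = B′} b≡a ρB ρR =
    subst (_⊢ _) (++-assoc L′ B′ _)
      (principal-cut-at D b≡a (≥-at B (++⁻ʳ L (presupposition E)))
        (↣L (multicut D f ρB) (multicut D e (ρL ++ᴿ keep ρR))))
  multicut D E@(&L₁ {ΩL = L} e) ρ with position L ρ
  ... | kept ρL ρR = &L₁ (multicut D e (ρL ++ᴿ keep ρR))
  ... | replaced b≡a ρL ρR =
    principal-cut-at D b≡a (≥-at L (presupposition E)) (&L₁ (multicut D e (ρL ++ᴿ keep ρR)))
  multicut D E@(&L₂ {ΩL = L} e) ρ with position L ρ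
  ... | kept ρL ρR = &L₂ (multicut D e (ρL ++ᴿ keep ρR))
  ... | replaced b≡a ρL ρR =
    principal-cut-at D b≡a (≥-at L (presupposition E)) (&L₂ (multicut D e (ρL ++ᴿ keep ρR)))
  multicut D E@(↑L {ΩL = L} l≽r e) ρ with position L ρ
  ... | kept ρL ρR = ↑L l≽r (multicut D e (ρL ++ᴿ keep ρR))
  ... | replaced b≡a ρL ρR =
    principal-cut-at D b≡a (≥-at L (presupposition E)) (↑L l≽r (multicut D e (ρL ++ᴿ keep ρR)))
  multicut D (Mˡ-rule {ΩL = L} {ΩM = M} h e) ρ =
    Mˡ-replace L M (presupposition D) h (multicut D e) ρ
  multicut D (Mʳ-rule {ΩL = L} {ΩM = M} h e) ρ =
    Mʳ-replace L M (presupposition D) h (multicut D e) ρ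
  multicut D (Cˡ-rule {ΩL = L} {ΩM = M} h e) ρ =
    Cˡ-replace L M (presupposition D) h (multicut D e) ρ
  multicut D (Cʳ-rule {ΩL = L} {ΩM = M} h e) ρ =
    Cʳ-replace L M (presupposition D) h (multicut D e) ρ
  multicut D (W-rule {ΩL = L} h s e) ρ = W-replace L (presupposition D) h s (multicut D e) ρ

module Erasure (MS : ModeSystem) where
  open ModeSystem MS
  open Calculus MS
  open Unlabelled MS using (Formula; ⟪_⟫; _⊢_; Replace; keep; replace)
  module U = Unlabelled MS

  propOf : (a : Ante) → Prop (modeOf a)
  propOf (_ ∶ A) = A

  formula : Ante → Formula
  formula a = modeOf a , propOf a

  ⌊_⌋ : Ctx → U.Context
  ⌊ Γ ⌋ = map formula Γ

  ⌊⌋-++ : ∀ Γ₁ Γ₂ → ⌊ Γ₁ ++ Γ₂ ⌋ ≡ ⌊ Γ₁ ⌋ ++ ⌊ Γ₂ ⌋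
  ⌊⌋-++ = map-++ formula

  ⌊⌋-++₃ : ∀ Γ₁ Γ₂ Γ₃ → ⌊ Γ₁ ++ Γ₂ ++ Γ₃ ⌋ ≡ ⌊ Γ₁ ⌋ ++ ⌊ Γ₂ ⌋ ++ ⌊ Γ₃ ⌋
  ⌊⌋-++₃ Γ₁ Γ₂ Γ₃ = trans (⌊⌋-++ Γ₁ _) (cong (⌊ Γ₁ ⌋ ++_) (⌊⌋-++ Γ₂ Γ₃))

  ≥-erase : ∀ {k} Γ₁ Γ₂ → (Γ₁ ++ Γ₂) ≥ctx k → ⌊ Γ₁ ⌋ ++ ⌊ Γ₂ ⌋ U.≥ k
  ≥-erase Γ₁ Γ₂ g = subst (U._≥ _) (⌊⌋-++ Γ₁ Γ₂) (map⁺ g)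

  ≥-label : ∀ {k} Γ₁ Γ₂ → ⌊ Γ₁ ⌋ ++ ⌊ Γ₂ ⌋ U.≥ k → (Γ₁ ++ Γ₂) ≥ctx k
  ≥-label Γ₁ Γ₂ g = map⁻ (subst (U._≥ _) (sym (⌊⌋-++ Γ₁ Γ₂)) g)

  module _ {r} {C : Prop r} where

    split⊢ : ∀ Γ₁ Γ₂ → ⌊ Γ₁ ++ Γ₂ ⌋ ⊢ C → ⌊ Γ₁ ⌋ ++ ⌊ Γ₂ ⌋ ⊢ C
    split⊢ Γ₁ Γ₂ = subst (_⊢ C) (⌊⌋-++ Γ₁ Γ₂)

    join⊢ : ∀ Γ₁ Γ₂ → ⌊ Γ₁ ⌋ ++ ⌊ Γ₂ ⌋ ⊢ C → ⌊ Γ₁ ++ Γ₂ ⌋ ⊢ C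
    join⊢ Γ₁ Γ₂ = subst (_⊢ C) (sym (⌊⌋-++ Γ₁ Γ₂))

    split₃⊢ : ∀ Γ₁ Γ₂ Γ₃ → ⌊ Γ₁ ++ Γ₂ ++ Γ₃ ⌋ ⊢ C → ⌊ Γ₁ ⌋ ++ ⌊ Γ₂ ⌋ ++ ⌊ Γ₃ ⌋ ⊢ C
    split₃⊢ Γ₁ Γ₂ Γ₃ = subst (_⊢ C) (⌊⌋-++₃ Γ₁ Γ₂ Γ₃)

    join₃⊢ : ∀ Γ₁ Γ₂ Γ₃ → ⌊ Γ₁ ⌋ ++ ⌊ Γ₂ ⌋ ++ ⌊ Γ₃ ⌋ ⊢ C → ⌊ Γ₁ ++ Γ₂ ++ Γ₃ ⌋ ⊢ C
    join₃⊢ Γ₁ Γ₂ Γ₃ = subst (_⊢ C) (sym (⌊⌋-++₃ Γ₁ Γ₂ Γ₃))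

  erase : ∀ {Γ r} {C : Prop r} → CutFree Γ C → ⌊ Γ ⌋ ⊢ C
  erase id = U.id
  erase (cut () _ _ _ _ _)
  erase 1R = U.1R
  erase (1L {ΩL = L} s d) = join⊢ L _ (U.1L (≥-erase L _ s) (split⊢ L _ (erase d)))
  erase (●R {Ω₁ = L} d e) = join⊢ L _ (U.●R (erase d) (erase e))
  erase (●L {ΩL = L} _ _ _ d) = join⊢ L _ (U.●L (split⊢ L _ (erase d)))
  erase (⊕R₁ d) = U.⊕R₁ (erase d)
  erase (⊕R₂ d) = U.⊕R₂ (erase d)
  erase (⊕L {ΩL = L} _ d e) = join⊢ L _ (U.⊕L (split⊢ L _ (erase d)) (split⊢ L _ (erase e)))
  erase (↓R s d) = U.↓R (map⁺ s) (erase d)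
  erase (↓L {ΩL = L} s _ d) = join⊢ L _ (U.↓L (≥-erase L _ s) (split⊢ L _ (erase d)))
  erase (↠R {Ω = Ω} _ d) = U.↠R (split⊢ Ω _ (erase d))
  erase (↠L {ΩA = B} {ΩL = L} s _ f d) =
    join₃⊢ L (_ ∷ B) _ (U.↠L (map⁺ s) (erase f) (split⊢ L _ (erase d)))
  erase (↣R _ d) = U.↣R (erase d)
  erase (↣L {ΩA = B} {ΩL = L} s _ f d) =
    join₃⊢ L B _ (U.↣L (map⁺ s) (erase f) (split⊢ L _ (erase d)))
  erase (&R d e) = U.&R (erase d) (erase e)
  erase (&L₁ {ΩL = L} _ d) = join⊢ L _ (U.&L₁ (split⊢ L _ (erase d)))
  erase (&L₂ {ΩL = L} _ d) = join⊢ L _ (U.&L₂ (split⊢ L _ (erase d)))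
  erase (↑R s d) = U.↑R (map⁺ s) (erase d)
  erase (↑L {ΩL = L} l≽r _ d) = join⊢ L _ (U.↑L l≽r (split⊢ L _ (erase d)))
  erase (Mˡ-rule {ΩL = L} {ΩM = M} h d) =
    join₃⊢ L (_ ∷ M) _ (U.Mˡ-rule h (split₃⊢ L M _ (erase d)))
  erase (Mʳ-rule {ΩL = L} {ΩM = M} h d) =
    join₃⊢ L M (_ ∷ _) (U.Mʳ-rule h (split₃⊢ L (_ ∷ M) _ (erase d)))
  erase (Cˡ-rule {ΩL = L} {ΩM = M} h d) =
    join₃⊢ L (_ ∷ M) _ (U.Cˡ-rule h (split₃⊢ L (_ ∷ M) (_ ∷ _) (erase d)))
  erase (Cʳ-rule {ΩL = L} {ΩM = M} h d) =
    join₃⊢ L M (_ ∷ _) (U.Cʳ-rule h (split₃⊢ L (_ ∷ M) (_ ∷ _) (erase d)))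
  erase (W-rule {ΩL = L} h s d) = join⊢ L _ (U.W-rule h (≥-erase L _ s) (split⊢ L _ (erase d)))

  ⌊⌋-++⁻ : ∀ Γ Δ₁ {Δ₂} → ⌊ Γ ⌋ ≡ Δ₁ ++ Δ₂ →
           ∃₂ λ Γ₁ Γ₂ → Γ ≡ Γ₁ ++ Γ₂ × ⌊ Γ₁ ⌋ ≡ Δ₁ × ⌊ Γ₂ ⌋ ≡ Δ₂
  ⌊⌋-++⁻ = map-++⁻ formula

  fresh : Ctx → ℕ
  fresh Γ = suc (max 0 (map varOf Γ))

  fresh-∉ : ∀ Γ {k} → fresh Γ ≤ k → k ∉vars Γ
  fresh-∉ Γ fresh≤k =
    All.map (λ x≤max → <⇒≢ (<-≤-trans (s≤s x≤max) fresh≤k)) (map⁻ (xs≤max 0 (map varOf Γ)))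

  fresh∉ : ∀ Γ → fresh Γ ∉vars Γ
  fresh∉ Γ = fresh-∉ Γ ≤-refl

  label : ∀ {Δ r} {C : Prop r} → Δ ⊢ C → ∀ Γ → ⌊ Γ ⌋ ≡ Δ → CutFree Γ C
  label U.id ((_ ∶ _) ∷ []) refl = id
  label U.1R [] refl = 1R
  label (U.1L {ΩL = L} s d) Γ eq with ⌊⌋-++⁻ Γ L eq
  ... | Γ₁ , (_ ∶ _) ∷ Γ₂ , refl , refl , refl =
    1L (≥-label Γ₁ (_ ∷ Γ₂) s) (label d (Γ₁ ++ Γ₂) (⌊⌋-++ Γ₁ Γ₂))
  label (U.●R {Ω₁ = L} d e) Γ eq with ⌊⌋-++⁻ Γ L eq
  ... | Γ₁ , Γ₂ , refl , refl , refl = ●R (label d Γ₁ refl) (label e Γ₂ refl)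
  label (U.●L {ΩL = L} {A = A} {B = B} d) Γ eq with ⌊⌋-++⁻ Γ L eq
  ... | Γ₁ , (x ∶ _) ∷ Γ₂ , refl , refl , refl =
    ●L (<⇒≢ (n<1+n y)) (fresh∉ Γ₀) (fresh-∉ Γ₀ (n≤1+n y))
       (label d (Γ₁ ++ (y ∶ A) ∷ (suc y ∶ B) ∷ Γ₂) (⌊⌋-++ Γ₁ _))
    where Γ₀ = Γ₁ ++ (x ∶ (A ● B)) ∷ Γ₂
          y  = fresh Γ₀
  label (U.⊕R₁ d) Γ eq = ⊕R₁ (label d Γ eq)
  label (U.⊕R₂ d) Γ eq = ⊕R₂ (label d Γ eq)
  label (U.⊕L {ΩL = L} {A = A} {B = B} d e) Γ eq with ⌊⌋-++⁻ Γ L eq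
  ... | Γ₁ , (x ∶ _) ∷ Γ₂ , refl , refl , refl =
    ⊕L (fresh∉ Γ₀) (label d (Γ₁ ++ (y ∶ A) ∷ Γ₂) (⌊⌋-++ Γ₁ _))
                          (label e (Γ₁ ++ (y ∶ B) ∷ Γ₂) (⌊⌋-++ Γ₁ _))
    where Γ₀ = Γ₁ ++ (x ∶ (A ⊕ B)) ∷ Γ₂
          y  = fresh Γ₀
  label (U.↓R s d) Γ refl = ↓R (map⁻ s) (label d Γ refl)
  label (U.↓L {ΩL = L} {p = p} {A = A} s d) Γ eq with ⌊⌋-++⁻ Γ L eq
  ... | Γ₁ , (x ∶ _) ∷ Γ₂ , refl , refl , refl =
    ↓L (≥-label Γ₁ (_ ∷ Γ₂) s) (fresh∉ Γ₀) (label d (Γ₁ ++ (fresh Γ₀ ∶ A) ∷ Γ₂) (⌊⌋-++ Γ₁ _))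
    where Γ₀ = Γ₁ ++ (x ∶ down p A) ∷ Γ₂
  label (U.↠R {A = A} d) Γ refl = ↠R (fresh∉ Γ) (label d (Γ ++ [ fresh Γ ∶ A ]) (⌊⌋-++ Γ _))
  label (U.↠L {ΩA = B} {ΩL = L} {A = A₁} {B = B₁} s f d) Γ eq with ⌊⌋-++⁻ Γ L eq
  ... | Γ₁ , (x ∶ _) ∷ Γ′ , refl , refl , eq′ with ∷-injective eq′
  ...   | refl , eq″ with ⌊⌋-++⁻ Γ′ B eq″
  ...     | ΓB , Γ₂ , refl , refl , refl =
    ↠L (map⁻ s) (fresh∉ Γ₀) (label f ΓB refl)
       (label d (Γ₁ ++ (fresh Γ₀ ∶ B₁) ∷ Γ₂) (⌊⌋-++ Γ₁ _))
    where Γ₀ = Γ₁ ++ (x ∶ (A₁ ↠ B₁)) ∷ ΓB ++ Γ₂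
  label (U.↣R {A = A} d) Γ refl = ↣R (fresh∉ Γ) (label d ((fresh Γ ∶ A) ∷ Γ) refl)
  label (U.↣L {ΩA = B} {ΩL = L} {A = A₁} {B = B₁} s f d) Γ eq with ⌊⌋-++⁻ Γ L eq
  ... | Γ₁ , Γ′ , refl , refl , eq′ with ⌊⌋-++⁻ Γ′ B eq′
  ...   | ΓB , (x ∶ _) ∷ Γ₂ , refl , refl , refl =
    ↣L (map⁻ s) (fresh∉ Γ₀) (label f ΓB refl)
       (label d (Γ₁ ++ (fresh Γ₀ ∶ B₁) ∷ Γ₂) (⌊⌋-++ Γ₁ _))
    where Γ₀ = Γ₁ ++ ΓB ++ (x ∶ (A₁ ↣ B₁)) ∷ Γ₂
  label (U.&R d e) Γ eq = &R (label d Γ eq) (label e Γ eq)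
  label (U.&L₁ {ΩL = L} {A = A} {B = B} d) Γ eq with ⌊⌋-++⁻ Γ L eq
  ... | Γ₁ , (x ∶ _) ∷ Γ₂ , refl , refl , refl =
    &L₁ (fresh∉ Γ₀) (label d (Γ₁ ++ (fresh Γ₀ ∶ A) ∷ Γ₂) (⌊⌋-++ Γ₁ _))
    where Γ₀ = Γ₁ ++ (x ∶ (A & B)) ∷ Γ₂
  label (U.&L₂ {ΩL = L} {A = A} {B = B} d) Γ eq with ⌊⌋-++⁻ Γ L eq
  ... | Γ₁ , (x ∶ _) ∷ Γ₂ , refl , refl , refl =
    &L₂ (fresh∉ Γ₀) (label d (Γ₁ ++ (fresh Γ₀ ∶ B) ∷ Γ₂) (⌊⌋-++ Γ₁ _))
    where Γ₀ = Γ₁ ++ (x ∶ (A & B)) ∷ Γ₂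
  label (U.↑R s d) Γ refl = ↑R (map⁻ s) (label d Γ refl)
  label (U.↑L {ΩL = L} {p = p} {A = A} l≽r d) Γ eq with ⌊⌋-++⁻ Γ L eq
  ... | Γ₁ , (x ∶ _) ∷ Γ₂ , refl , refl , refl =
    ↑L l≽r (fresh∉ Γ₀) (label d (Γ₁ ++ (fresh Γ₀ ∶ A) ∷ Γ₂) (⌊⌋-++ Γ₁ _))
    where Γ₀ = Γ₁ ++ (x ∶ up p A) ∷ Γ₂
  label (U.Mˡ-rule {ΩL = L} {ΩM = M} h d) Γ eq with ⌊⌋-++⁻ Γ L eq
  ... | Γ₁ , a@(_ ∶ _) ∷ Γ′ , refl , refl , eq′ with ∷-injective eq′
  ...   | refl , eq″ with ⌊⌋-++⁻ Γ′ M eq″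
  ...     | ΓM , Γ₂ , refl , refl , refl =
    Mˡ-rule h (label d (Γ₁ ++ ΓM ++ a ∷ Γ₂) (⌊⌋-++₃ Γ₁ ΓM _))
  label (U.Mʳ-rule {ΩL = L} {ΩM = M} h d) Γ eq with ⌊⌋-++⁻ Γ L eq
  ... | Γ₁ , Γ′ , refl , refl , eq′ with ⌊⌋-++⁻ Γ′ M eq′
  ...   | ΓM , a@(_ ∶ _) ∷ Γ₂ , refl , refl , refl =
    Mʳ-rule h (label d (Γ₁ ++ a ∷ ΓM ++ Γ₂) (⌊⌋-++₃ Γ₁ (a ∷ ΓM) _))
  label (U.Cˡ-rule {ΩL = L} {ΩM = M} h d) Γ eq with ⌊⌋-++⁻ Γ L eq
  ... | Γ₁ , a@(_ ∶ _) ∷ Γ′ , refl , refl , eq′ with ∷-injective eq′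
  ...   | refl , eq″ with ⌊⌋-++⁻ Γ′ M eq″
  ...     | ΓM , Γ₂ , refl , refl , refl =
    Cˡ-rule h (label d (Γ₁ ++ a ∷ ΓM ++ a ∷ Γ₂) (⌊⌋-++₃ Γ₁ (a ∷ ΓM) _))
  label (U.Cʳ-rule {ΩL = L} {ΩM = M} h d) Γ eq with ⌊⌋-++⁻ Γ L eq
  ... | Γ₁ , Γ′ , refl , refl , eq′ with ⌊⌋-++⁻ Γ′ M eq′
  ...   | ΓM , a@(_ ∶ _) ∷ Γ₂ , refl , refl , refl =
    Cʳ-rule h (label d (Γ₁ ++ a ∷ ΓM ++ a ∷ Γ₂) (⌊⌋-++₃ Γ₁ (a ∷ ΓM) _))
  label (U.W-rule {ΩL = L} h s d) Γ eq with ⌊⌋-++⁻ Γ L eq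
  ... | Γ₁ , (_ ∶ _) ∷ Γ₂ , refl , refl , refl =
    W-rule h (≥-label Γ₁ (_ ∷ Γ₂) s) (label d (Γ₁ ++ Γ₂) (⌊⌋-++ Γ₁ Γ₂))

  fill-replace : ∀ {m} {A : Prop m} x ΩA Ω →
                 Replace ⟪ A ⟫ ⌊ ΩA ⌋ ⌊ fill Ω [ x ∶ A ] ⌋ ⌊ fill Ω ΩA ⌋
  fill-replace x ΩA []          = U.[]
  fill-replace x ΩA (hole ∷ Ω)  =
    subst (Replace _ ⌊ ΩA ⌋ _) (sym (⌊⌋-++ ΩA _)) (replace (fill-replace x ΩA Ω))
  fill-replace x ΩA (ant _ ∷ Ω) = keep (fill-replace x ΩA Ω)

theorem1 : (MS : ModeSystem) → let open Calculus MS in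
    ∀ {m r : ModeSystem.Mode MS} (ΩA : Ctx) (A : Prop m) (C : Prop r) (x : ℕ) (Ω : HCtx) →
    WellFormed ΩA → WellFormed (fill Ω [ x ∶ A ]) →
    ΩA ≥ctx m → ModeSystem._≽_ MS m r → Compat m (holes Ω) →
    x ∉vars ΩA → x ∉hvars Ω →
    CutFree ΩA A → CutFree (fill Ω [ x ∶ A ]) C →
    CutFree (fill Ω ΩA) C
-- Only the two derivations are used: Ω_A ≥ m and m ≥ r follow from them, the conditions on
-- variables are void once labels are erased, and the multicut is admissible for any number
-- of occurrences.
theorem1 MS ΩA A C x Ω _ _ _ _ _ _ _ ⊢A ⊢C =
  label (multicut (erase ⊢A) (erase ⊢C) (fill-replace x ΩA Ω)) (fill Ω ΩA) refl
  where
    open Calculus MS using (fill)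
    open Unlabelled MS using (multicut)
    open Erasure MS using (erase; label; fill-replace)
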